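{- Let $X$ be a set and $k$ a positive integer. If $(\mathcal{A}_i)_{i=0}^{k-1}$ is a layered sequence of pairwise disjoint saturated antichains in $\mathcal{P}(X)$, then $\mathcal{F}:=\bigcup_{i=0}^{k-1}\mathcal{A}_i$ is a saturated $k$-Sperner system.
   Context: A collection $\mathcal{A}\subseteq\mathcal{P}(X)$ is an antichain if there are no $A,B\in\mathcal{A}$ with $A\subsetneq B$; it is saturated if moreover for every $S\in\mathcal{P}(X)\setminus\mathcal{A}$ there is $A\in\mathcal{A}$ with $A\subsetneq S$ or $S\subsetneq A$. A sequence $(\mathcal{D}_i)_{i=0}^{t}$ of subsets of $\mathcal{P}(X)$ is layered if for $1\le i\le t$, every $D\in\mathcal{D}_i$ strictly contains some $D'\in\mathcal{D}_{i-1}$. $\mathcal{F}\subseteq\mathcal{P}(X)$ is a $k$-Sperner system if it contains no $(k+1)$-chain $A_1\subsetneq\dots\subsetneq A_{k+1}$ with all $A_j\in\mathcal{F}$; it is saturated if additionally $\mathcal{F}\cup\{S\}$ contains a $(k+1)$-chain for every $S\in\mathcal{P}(X)\setminus\mathcal{F}$. -}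

module Defs where

open import Level using (Level; 0ℓ; _⊔_)
open import Data.Nat using (ℕ; suc)
open import Data.Fin using (Fin; toℕ)
open import Data.Product using (Σ; ∃; _×_; _,_)
open import Data.Sum using (_⊎_)
open import Relation.Nullary using (¬_)
open import Relation.Binary.PropositionalEquality using (_≡_; _≢_)
open import Relation.Unary using (Pred; _∈_; _∉_; _⊂_; _∪_; ｛_｝)

-- Elements of the power set P(X): subsets of X, as predicates on X.
-- Strict inclusion A ⊊ B is the stdlib  A ⊂ B  (A ⊆ B and not B ⊆ A).
Subset : Set → Set₁
Subset X = Pred X 0ℓ

Family : Set → Set₁
Family X = Pred (Subset X) 0ℓ

module _ {X : Set} where

  IsAntichain : Family X → Set₁
  IsAntichain 𝒜 = ∀ A B → A ∈ 𝒜 → B ∈ 𝒜 → ¬ (A ⊂ B)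

  IsSaturatedAntichain : Family X → Set₁
  IsSaturatedAntichain 𝒜 =
    IsAntichain 𝒜 ×
    (∀ S → S ∉ 𝒜 → Σ (Subset X) λ A → A ∈ 𝒜 × (A ⊂ S ⊎ S ⊂ A))

  -- (𝒟_i)_{i=0}^{n-1} layered: for i ≥ 1 every D ∈ 𝒟_i strictly contains
  -- some D' ∈ 𝒟_{i-1}  (j plays the role of i, i of i-1)
  IsLayered : {n : ℕ} → (Fin n → Family X) → Set₁
  IsLayered {n} 𝒟 = ∀ (i j : Fin n) → toℕ j ≡ suc (toℕ i) →
    ∀ D → D ∈ 𝒟 j → Σ (Subset X) λ D' → D' ∈ 𝒟 i × D' ⊂ D

  PairwiseDisjoint : {n : ℕ} → (Fin n → Family X) → Set₁
  PairwiseDisjoint {n} 𝒟 = ∀ (i j : Fin n) → i ≢ j → ∀ S → S ∈ 𝒟 i → S ∉ 𝒟 j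

  ⋃ : {n : ℕ} → (Fin n → Family X) → Family X
  ⋃ {n} 𝒟 S = ∃ λ (i : Fin n) → S ∈ 𝒟 i

  -- ℱ contains an m-chain A_1 ⊊ A_2 ⊊ … ⊊ A_m (indexed by Fin m)
  -- (level-polymorphic so that it applies to ℱ ∪ ｛ S ｝)
  HasChain : {ℓ : Level} → ℕ → Pred (Subset X) ℓ → Set (Level.suc 0ℓ ⊔ ℓ)
  HasChain m ℱ = Σ (Fin m → Subset X) λ C →
    (∀ i → C i ∈ ℱ) ×
    (∀ (i j : Fin m) → toℕ j ≡ suc (toℕ i) → C i ⊂ C j)

  IsKSperner : ℕ → Family X → Set₁
  IsKSperner k ℱ = ¬ HasChain (suc k) ℱ

  IsSaturatedKSperner : ℕ → Family X → Set₁
  IsSaturatedKSperner k ℱ =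
    IsKSperner k ℱ × (∀ S → S ∉ ℱ → HasChain (suc k) (ℱ ∪ ｛ S ｝))

-- A chain in the union meets each antichain at most once (pigeonhole), so it has at most
-- k elements.  For saturation take S outside the union.  Every element of 𝒜ᵢ tops a chain
-- through 𝒜₀, …, 𝒜ᵢ (layering) and is the bottom of a chain through 𝒜ᵢ, …, 𝒜ₖ₋₁: it is
-- comparable to some B ∈ 𝒜ᵢ₊₁, and B cannot lie below it since B contains an element of
-- the antichain 𝒜ᵢ.  Scanning the layers upwards, S is comparable to an element of each.
-- At the first layer with an element above S, put S between the chain below the previous
-- layer's element under S and the chain above; if there is no such layer, extend the
-- chain below the top layer's element under S by S.
module Submission where

open import Defs
open import Level using (Level; 0ℓ; _⊔_)
open import Function using (_∘_)
open import Data.Nat using (ℕ; zero; suc; _+_; _≤_; z≤n; s≤s)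
open import Data.Nat.Properties using (+-suc; ≤-refl; suc-injective)
open import Data.Fin using (Fin; toℕ; _<_) renaming (zero to fzero; suc to fsuc)
open import Data.Fin.Properties using (pigeonhole) renaming (suc-injective to fsuc-injective)
open import Data.Empty using (⊥-elim)
open import Data.Product using (Σ; ∃; _×_; _,_; proj₁; proj₂)
open import Data.Sum using (inj₁; inj₂)
open import Relation.Binary.PropositionalEquality using (_≡_; refl; sym; cong; subst)
open import Relation.Unary using (Pred; _∈_; _∉_; _⊆_; _⊂_; _∪_; ｛_｝)
open import Relation.Unary.Properties using (⊂-trans)

module _ {X : Set} where

  Ascending : {m : ℕ} → (Fin m → Subset X) → Set
  Ascending {m} C = ∀ (i j : Fin m) → toℕ j ≡ suc (toℕ i) → C i ⊂ C j

  ascending-suc : {m : ℕ} {C : Fin (suc m) → Subset X} → Ascending C → Ascending (C ∘ fsuc)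
  ascending-suc asc i j e = asc (fsuc i) (fsuc j) (cong suc e)

  ascending⇒⊂ : {m : ℕ} (C : Fin m → Subset X) → Ascending C →
                ∀ {a b} → a < b → C a ⊂ C b
  ascending⇒⊂ C asc {fzero}  {fsuc fzero}    _         = asc fzero (fsuc fzero) refl
  ascending⇒⊂ C asc {fzero}  {fsuc (fsuc b)} _         =
    ⊂-trans (asc fzero (fsuc fzero) refl)
            (ascending⇒⊂ (C ∘ fsuc) (ascending-suc asc) {fzero} {fsuc b} (s≤s z≤n))
  ascending⇒⊂ C asc {fsuc a} {fsuc b}        (s≤s a<b) = ascending⇒⊂ (C ∘ fsuc) (ascending-suc asc) a<b

  ⋃-antichains-isKSperner : {k : ℕ} (𝒜 : Fin k → Family X) → (∀ i → IsAntichain (𝒜 i)) →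
                            IsKSperner k (⋃ 𝒜)
  ⋃-antichains-isKSperner 𝒜 antichain (C , C∈ , asc)
    with a , b , a<b , same-layer ← pigeonhole ≤-refl (proj₁ ∘ C∈) =
    antichain (proj₁ (C∈ b)) (C a) (C b)
      (subst (λ i → C a ∈ 𝒜 i) same-layer (proj₂ (C∈ a))) (proj₂ (C∈ b))
      (ascending⇒⊂ C asc a<b)

  infixr 5 _∷⟨_⟩_

  data Chain {ℓ : Level} (P : Pred (Subset X) ℓ) : ℕ → Subset X → Subset X → Set (Level.suc 0ℓ ⊔ ℓ) where
    [_]    : ∀ {A} → A ∈ P → Chain P 1 A A
    _∷⟨_⟩_ : ∀ {n A B Z} → A ∈ P → A ⊂ B → Chain P n B Z → Chain P (suc n) A Z

  module _ {ℓ : Level} {P : Pred (Subset X) ℓ} where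

    infixr 5 _++⟨_⟩_
    infixl 5 _∷ʳ⟨_⟩_

    _∷ʳ⟨_⟩_ : ∀ {n A Z W} → Chain P n A Z → Z ⊂ W → W ∈ P → Chain P (suc n) A W
    [ A∈ ]          ∷ʳ⟨ Z⊂W ⟩ W∈ = A∈ ∷⟨ Z⊂W ⟩ [ W∈ ]
    (A∈ ∷⟨ A⊂B ⟩ c) ∷ʳ⟨ Z⊂W ⟩ W∈ = A∈ ∷⟨ A⊂B ⟩ (c ∷ʳ⟨ Z⊂W ⟩ W∈)

    _++⟨_⟩_ : ∀ {n m A Z W V} → Chain P n A Z → Z ⊂ W → Chain P m W V → Chain P (n + m) A V
    [ A∈ ]          ++⟨ Z⊂W ⟩ d = A∈ ∷⟨ Z⊂W ⟩ d
    (A∈ ∷⟨ A⊂B ⟩ c) ++⟨ Z⊂W ⟩ d = A∈ ∷⟨ A⊂B ⟩ (c ++⟨ Z⊂W ⟩ d)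

    lookup : ∀ {n A Z} → Chain P n A Z → Fin n → Subset X
    lookup {A = A} _ fzero    = A
    lookup (_ ∷⟨ _ ⟩ c) (fsuc i) = lookup c i

    lookup-zero : ∀ {n A Z} (c : Chain P (suc n) A Z) → lookup c fzero ≡ A
    lookup-zero [ _ ]        = refl
    lookup-zero (_ ∷⟨ _ ⟩ _) = refl

    lookup-∈ : ∀ {n A Z} (c : Chain P n A Z) (i : Fin n) → lookup c i ∈ P
    lookup-∈ [ A∈ ]          fzero    = A∈
    lookup-∈ (A∈ ∷⟨ _ ⟩ _)   fzero    = A∈
    lookup-∈ (_ ∷⟨ _ ⟩ c)    (fsuc i) = lookup-∈ c i

    lookup-ascending : ∀ {n A Z} (c : Chain P n A Z) → Ascending (lookup c)
    lookup-ascending (_ ∷⟨ A⊂B ⟩ c) fzero    (fsuc fzero) _ =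
      subst (_ ⊂_) (sym (lookup-zero c)) A⊂B
    lookup-ascending (_ ∷⟨ _ ⟩ c)   (fsuc i) (fsuc j)     e =
      lookup-ascending c i j (suc-injective e)

    toHasChain : ∀ {n A Z} → Chain P n A Z → HasChain n P
    toHasChain c = lookup c , lookup-∈ c , lookup-ascending c

  record IsSaturatedLayering {n : ℕ} (𝒜 : Fin n → Family X) : Set₁ where
    field
      layered   : IsLayered 𝒜
      disjoint  : PairwiseDisjoint 𝒜
      saturated : ∀ i → IsSaturatedAntichain (𝒜 i)

  ⋃-suc⊆⋃ : {n : ℕ} (𝒜 : Fin (suc n) → Family X) → ⋃ (𝒜 ∘ fsuc) ⊆ ⋃ 𝒜
  ⋃-suc⊆⋃ 𝒜 (i , A∈) = fsuc i , A∈

  module _ {n : ℕ} {𝒜 : Fin (suc n) → Family X} where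

    isSaturatedLayering-suc : IsSaturatedLayering 𝒜 → IsSaturatedLayering (𝒜 ∘ fsuc)
    isSaturatedLayering-suc L = record
      { layered   = λ i j e → layered (fsuc i) (fsuc j) (cong suc e)
      ; disjoint  = λ i j i≢j → disjoint (fsuc i) (fsuc j) (i≢j ∘ fsuc-injective)
      ; saturated = saturated ∘ fsuc
      }
      where open IsSaturatedLayering L

  module _ {n : ℕ} {𝒜 : Fin (suc (suc n)) → Family X} (L : IsSaturatedLayering 𝒜) where
    open IsSaturatedLayering L

    below-layer₁ : ∀ {B} → B ∈ 𝒜 (fsuc fzero) → Σ (Subset X) λ A → A ∈ 𝒜 fzero × A ⊂ B
    below-layer₁ = layered fzero (fsuc fzero) refl _

    above-layer₀ : ∀ {A} → A ∈ 𝒜 fzero → Σ (Subset X) λ B → B ∈ 𝒜 (fsuc fzero) × A ⊂ B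
    above-layer₀ {A} A∈
      with proj₂ (saturated (fsuc fzero)) A (disjoint fzero (fsuc fzero) (λ ()) A A∈)
    ... | B , B∈ , inj₂ A⊂B = B , B∈ , A⊂B
    ... | B , B∈ , inj₁ B⊂A with D , D∈ , D⊂B ← below-layer₁ B∈ =
      ⊥-elim (proj₁ (saturated fzero) D A D∈ A∈ (⊂-trans D⊂B B⊂A))

  module _ {ℓ : Level} {Q : Pred (Subset X) ℓ} where

    chain-above : ∀ {n} {𝒜 : Fin (suc n) → Family X} → IsSaturatedLayering 𝒜 → ⋃ 𝒜 ⊆ Q →
                  ∀ {A} → A ∈ 𝒜 fzero → ∃ λ Z → Chain Q (suc n) A Z
    chain-above {zero}  L ⋃⊆Q A∈ = _ , [ ⋃⊆Q (fzero , A∈) ]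
    chain-above {suc n} {𝒜} L ⋃⊆Q A∈
      with B , B∈ , A⊂B ← above-layer₀ L A∈
      with Z , c ← chain-above (isSaturatedLayering-suc L) (⋃⊆Q ∘ ⋃-suc⊆⋃ 𝒜) B∈ =
      Z , ⋃⊆Q (fzero , A∈) ∷⟨ A⊂B ⟩ c

    chain-through : ∀ {n m} {𝒜 : Fin (suc n) → Family X} → IsSaturatedLayering 𝒜 → ⋃ 𝒜 ⊆ Q →
                    ∀ {S} → S ∈ Q → S ∉ ⋃ 𝒜 →
                    (∀ {A} → A ∈ 𝒜 fzero → ∃ λ F → Chain Q m F A) →
                    ∀ {A} → A ∈ 𝒜 fzero → A ⊂ S → HasChain (m + suc n) Q
    chain-through {zero} L ⋃⊆Q S∈ S∉ below A∈ A⊂S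
      with F , c ← below A∈ = toHasChain (c ++⟨ A⊂S ⟩ [ S∈ ])
    chain-through {suc n} {m} {𝒜} L ⋃⊆Q {S} S∈ S∉ below A∈ A⊂S
      with proj₂ (IsSaturatedLayering.saturated L (fsuc fzero)) S (S∉ ∘ (fsuc fzero ,_))
    ... | B , B∈ , inj₂ S⊂B
      with F , c ← below A∈
         | Z , d ← chain-above (isSaturatedLayering-suc L) (⋃⊆Q ∘ ⋃-suc⊆⋃ 𝒜) B∈ =
      toHasChain (c ++⟨ A⊂S ⟩ S∈ ∷⟨ S⊂B ⟩ d)
    ... | B , B∈ , inj₁ B⊂S =
      subst (λ l → HasChain l Q) (sym (+-suc m (suc n)))
        (chain-through (isSaturatedLayering-suc L) (⋃⊆Q ∘ ⋃-suc⊆⋃ 𝒜) S∈ (S∉ ∘ ⋃-suc⊆⋃ 𝒜)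
                       chain-below-layer₁ B∈ B⊂S)
      where
        chain-below-layer₁ : ∀ {B} → B ∈ 𝒜 (fsuc fzero) → ∃ λ F → Chain Q (suc m) F B
        chain-below-layer₁ B∈ with D , D∈ , D⊂B ← below-layer₁ L B∈ with F , c ← below D∈ =
          F , c ∷ʳ⟨ D⊂B ⟩ ⋃⊆Q (fsuc fzero , B∈)

  ⋃-saturatedLayering-∪-hasChain : ∀ {n} {𝒜 : Fin (suc n) → Family X} → IsSaturatedLayering 𝒜 →
                                   ∀ S → S ∉ ⋃ 𝒜 → HasChain (suc (suc n)) (⋃ 𝒜 ∪ ｛ S ｝)
  ⋃-saturatedLayering-∪-hasChain {𝒜 = 𝒜} L S S∉
    with proj₂ (IsSaturatedLayering.saturated L fzero) S (S∉ ∘ (fzero ,_))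
  ... | A , A∈ , inj₁ A⊂S =
    chain-through {Q = ⋃ 𝒜 ∪ ｛ S ｝} L inj₁ (inj₂ refl) S∉ (λ B∈ → _ , [ inj₁ (fzero , B∈) ]) A∈ A⊂S
  ... | A , A∈ , inj₂ S⊂A with Z , c ← chain-above {Q = ⋃ 𝒜 ∪ ｛ S ｝} L inj₁ A∈ =
    toHasChain (inj₂ refl ∷⟨ S⊂A ⟩ c)

lemma2p8 : (X : Set) (k : ℕ) → 1 ≤ k → (𝒜 : Fin k → Family X) →
    IsLayered 𝒜 → PairwiseDisjoint 𝒜 → (∀ i → IsSaturatedAntichain (𝒜 i)) →
    IsSaturatedKSperner k (⋃ 𝒜)
lemma2p8 X (suc n) (s≤s z≤n) 𝒜 layered disjoint saturated =
  ⋃-antichains-isKSperner 𝒜 (proj₁ ∘ saturated) ,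
  ⋃-saturatedLayering-∪-hasChain
    (record { layered = layered ; disjoint = disjoint ; saturated = saturated })
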